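{- Let $G=(V,E)$ be an $n$-node DAG, let $p$ demand pairs arrive online (each with the target reachable from the source in $G$), and in each round generate a path for the current pair and add its edges to the current preserver $H$ (initially empty). Then the final preserver satisfies $$|E(H)|\le O\left((np|S|)^{1/2}+n\right)$$ in either of the following settings: (i) $P\subseteq S\times V$ and every path is generated by \texttt{backwards-growth}; (ii) $P\subseteq V\times S$ and every path is generated by \texttt{forwards-growth}. Here $P$ is the set of demand pairs and $S\subseteq V$.
   Context: \texttt{forwards-growth}$(G,H,(s,t))$: start with $\pi=(s)$; while the last node $u$ of $\pi$ is not $t$: if there is an edge $(u,v)\in E(H)$ with $t$ reachable from $v$ in $G$, append any such $v$; otherwise append any $v$ with $(u,v)\in E(G)$ and $t$ reachable from $v$. \texttt{backwards-growth}$(G,H,(s,t))$: start with $\pi=(t)$; while the first node $v$ of $\pi$ is not $s$: if there is $(u,v)\in E(H)$ with $u$ reachable from $s$, prepend any such $u$; otherwise prepend any $u$ with $(u,v)\in E(G)$ and $u$ reachable from $s$. Choices among admissible edges are arbitrary; the bound holds for all such choices. -}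

module Defs where

open import Data.Nat using (ℕ)
open import Data.Fin using (Fin)
open import Data.Fin.Properties using () renaming (_≟_ to _≟ᶠ_)
open import Data.Product using (Σ; ∃; _×_; _,_)
open import Data.Product.Properties using (≡-dec)
open import Data.Sum using (_⊎_)
open import Data.List using (List; []; _∷_; _++_; [_]; length; deduplicate)
open import Data.List.Membership.Propositional using (_∈_)
open import Relation.Binary.PropositionalEquality using (_≡_; _≢_)
open import Relation.Nullary using (¬_)
open import Relation.Binary.Construct.Closure.ReflexiveTransitive using (Star)
open import Relation.Binary.Construct.Closure.Transitive using (TransClosure)

Graph : ℕ → Set₁
Graph n = Fin n → Fin n → Set

IsDAG : ∀ {n} → Graph n → Set
IsDAG {n} G = ∀ (v : Fin n) → ¬ TransClosure G v v

Reach : ∀ {n} → Graph n → Fin n → Fin n → Set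
Reach G = Star G

pathEdges : ∀ {n} → List (Fin n) → List (Fin n × Fin n)
pathEdges [] = []
pathEdges (u ∷ []) = []
pathEdges (u ∷ v ∷ vs) = (u , v) ∷ pathEdges (v ∷ vs)

-- A preserver H is represented by a list of edges (possibly with repeats);
-- its edge relation:
EdgeIn : ∀ {n} → List (Fin n × Fin n) → Graph n
EdgeIn H u v = (u , v) ∈ H

numEdges : ∀ {n} → List (Fin n × Fin n) → ℕ
numEdges H = length (deduplicate (≡-dec _≟ᶠ_ _≟ᶠ_) H)

FwdStep : ∀ {n} → Graph n → List (Fin n × Fin n) → Fin n → Fin n → Fin n → Set
FwdStep {n} G H t u v =
  (EdgeIn H u v × Reach G v t)
  ⊎ ((¬ ∃ λ (w : Fin n) → EdgeIn H u w × Reach G w t) × G u v × Reach G v t)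

-- FwdFrom G H t u π : running the loop from a current path whose last node
-- is u, the nodes appended (in order) are π.
data FwdFrom {n} (G : Graph n) (H : List (Fin n × Fin n)) (t : Fin n)
     : Fin n → List (Fin n) → Set where
  done : ∀ {u} → u ≡ t → FwdFrom G H t u []
  step : ∀ {u v π} → u ≢ t → FwdStep G H t u v → FwdFrom G H t v π
       → FwdFrom G H t u (v ∷ π)

ForwardsGrowth : ∀ {n} → Graph n → List (Fin n × Fin n) → Fin n → Fin n
               → List (Fin n) → Set
ForwardsGrowth G H s t π = Σ _ λ rest → (π ≡ s ∷ rest) × FwdFrom G H t s rest

BwdStep : ∀ {n} → Graph n → List (Fin n × Fin n) → Fin n → Fin n → Fin n → Set
BwdStep {n} G H s u v =
  (EdgeIn H u v × Reach G s u)
  ⊎ ((¬ ∃ λ (w : Fin n) → EdgeIn H w v × Reach G s w) × G u v × Reach G s u)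

-- BwdFrom G H s v X : running the loop from a current path whose first node
-- is v, the nodes prepended overall form the list X (so the final path is
-- X ++ (current path)).
data BwdFrom {n} (G : Graph n) (H : List (Fin n × Fin n)) (s : Fin n)
     : Fin n → List (Fin n) → Set where
  done : ∀ {v} → v ≡ s → BwdFrom G H s v []
  step : ∀ {u v X} → v ≢ s → BwdStep G H s u v → BwdFrom G H s u X
       → BwdFrom G H s v (X ++ [ u ])

BackwardsGrowth : ∀ {n} → Graph n → List (Fin n × Fin n) → Fin n → Fin n
                → List (Fin n) → Set
BackwardsGrowth G H s t π = Σ _ λ X → (π ≡ X ++ [ t ]) × BwdFrom G H s t X

-- Online process: pairs arrive in order; each round's path is generated
-- by the given procedure w.r.t. the current preserver H (the edges of all
-- previous paths), and its edges are added to H.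

Generator : ℕ → Set₁
Generator n = Graph n → List (Fin n × Fin n) → Fin n → Fin n → List (Fin n) → Set

data OnlineRun {n} (Gen : Generator n) (G : Graph n)
     : List (Fin n × Fin n) → List (Fin n × Fin n) → List (Fin n × Fin n) → Set where
  -- OnlineRun Gen G Hcur pairs Hfinal
  finish : ∀ {H} → OnlineRun Gen G H [] H
  round  : ∀ {H s t ps π Hf} → Gen G H s t π
         → OnlineRun Gen G (H ++ pathEdges π) ps Hf
         → OnlineRun Gen G H ((s , t) ∷ ps) Hf

{-# OPTIONS --safe #-}
-- Let d(v) be the in-degree of v in the preserver H, and call v exposed for s when s
-- reaches v in G but reaches no H-in-neighbour of v. Backwards-growth from s ∈ S only
-- adds a new edge (u , v) when v is exposed for s and s reaches u, after which v is no
-- longer exposed for s. Since the new edges lie on one path of a DAG, each node gains at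
-- most one in-edge per round, and for every t at most one node gaining an in-edge stays
-- exposed for t. So for Ψ = Σ_{t ∈ S} Σ_{v exposed for t} d(v), a round raises
-- Σ d(v)² − Σ d(v) by 2 Σ_{v gaining} d(v) while 2 Ψ grows by at most 2 |S| minus that.
-- After p rounds Σ d(v)² + 2 Ψ ≤ |E(H)| + 2 p |S|, and Cauchy–Schwarz gives
-- |E(H)|² ≤ n Σ d(v)² ≤ n |E(H)| + 2 n p |S|, whence |E(H)|² ≤ 4 (n p |S| + n²).
-- Forwards-growth is backwards-growth in the reversed graph, on reversed edges.
module Submission where

open import Defs

open import Level using (Level; _⊔_)
open import Function using (flip; _∘_)
open import Data.Empty using (⊥-elim)
open import Data.Nat using (ℕ; zero; suc; _+_; _*_; _≤_; z≤n)
open import Data.Nat.Properties hiding (suc-injective; 0≢1+n)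
open import Data.Nat.Tactic.RingSolver using (solve-∀)
open import Data.Fin using (Fin; zero; suc; punchIn)
open import Data.Fin.Properties using (any?; suc-injective; 0≢1+n) renaming (_≟_ to _≟ᶠ_)
open import Data.Fin.Subset using (Subset; inside; outside; _∈_; ∣_∣)
open import Data.Fin.Subset.Properties using (_∈?_; drop-there)
open import Data.Vec.Base using (_∷_; []; there)
open import Data.Vec.Functional using (removeAt)
open import Data.Sum using (_⊎_; inj₁; inj₂; [_,_]′)
open import Data.Product using (Σ; ∃; _×_; _,_; proj₁; proj₂; swap)
open import Data.Product.Properties using (≡-dec)
open import Data.List using (List; []; _∷_; _++_; [_]; length; map)
open import Data.List.Properties using (map-++)
open import Data.List.Relation.Unary.Any using (here; there)
open import Data.List.Relation.Unary.All as All using (All; []; _∷_)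
open import Data.List.Relation.Unary.AllPairs using (_∷_)
open import Data.List.Relation.Unary.Unique.Propositional using (Unique)
open import Data.List.Relation.Unary.Unique.DecPropositional.Properties using (deduplicate-!)
open import Data.List.Membership.Propositional using () renaming (_∈_ to _∈ₗ_; _∉_ to _∉ₗ_)
open import Data.List.Membership.Propositional.Properties
  using (∈-deduplicate⁻; ∈-deduplicate⁺; ∈-map⁺; ∈-map⁻; ∈-++⁺ˡ; ∈-++⁺ʳ; ∈-++⁻)
open import Relation.Nullary using (¬_; Dec; yes; no)
open import Relation.Nullary.Decidable using (_×-dec_; ¬?; ¬¬-excluded-middle; decidable-stable)
open import Relation.Nullary.Negation using (¬¬-map)
open import Relation.Unary using (Pred)
open import Relation.Binary using (Rel; Decidable)
open import Relation.Binary.PropositionalEquality hiding ([_])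
open import Relation.Binary.Construct.Closure.ReflexiveTransitive
  using (Star; ε; _◅_; _◅◅_; return; reverse)
open import Relation.Binary.Construct.Closure.Transitive
  using (TransClosure) renaming ([_] to [_]⁺; _∷_ to _∷⁺_)
open import Algebra.Properties.CommutativeSemigroup +-commutativeSemigroup using (xy∙z≈xz∙y)
open import Algebra.Properties.Semiring.Sum +-*-semiring
  using ( sum; sum-syntax; sum-cong-≗; sum-replicate-zero; sum-remove
        ; ∑-distrib-+; ∑-comm; *-distribˡ-sum; *-distribʳ-sum )

private
  variable
    p q : Level
    P : Set p
    Q : Set q

-- Indicators and finite sums

𝟙 : Dec P → ℕ
𝟙 (yes _) = 1
𝟙 (no _)  = 0

𝟙-≤1 : (P? : Dec P) → 𝟙 P? ≤ 1
𝟙-≤1 (yes _) = ≤-refl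
𝟙-≤1 (no _)  = z≤n

𝟙-yes : P → (P? : Dec P) → 𝟙 P? ≡ 1
𝟙-yes p (yes _) = refl
𝟙-yes p (no ¬p) = ⊥-elim (¬p p)

𝟙-no : ¬ P → (P? : Dec P) → 𝟙 P? ≡ 0
𝟙-no ¬p (yes p) = ⊥-elim (¬p p)
𝟙-no ¬p (no _)  = refl

𝟙-mono : (P → Q) → (P? : Dec P) (Q? : Dec Q) → 𝟙 P? ≤ 𝟙 Q?
𝟙-mono P⇒Q (yes p) Q? = ≤-reflexive (sym (𝟙-yes (P⇒Q p) Q?))
𝟙-mono P⇒Q (no _)  Q? = z≤n

𝟙-cong : (P → Q) → (Q → P) → (P? : Dec P) (Q? : Dec Q) → 𝟙 P? ≡ 𝟙 Q?
𝟙-cong P⇒Q Q⇒P P? Q? = ≤-antisym (𝟙-mono P⇒Q P? Q?) (𝟙-mono Q⇒P Q? P?)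

𝟙-× : (P? : Dec P) (Q? : Dec Q) → 𝟙 (P? ×-dec Q?) ≡ 𝟙 P? * 𝟙 Q?
𝟙-× (yes _) (yes _) = refl
𝟙-× (yes _) (no _)  = refl
𝟙-× (no _)  Q?      = refl

+-𝟙-square : ∀ a (P? : Dec P) → (a + 𝟙 P?) * (a + 𝟙 P?) ≡ a * a + 2 * (a * 𝟙 P?) + 𝟙 P?
+-𝟙-square a (yes _) = +1-square a
  where
  +1-square : ∀ a → (a + 1) * (a + 1) ≡ a * a + 2 * (a * 1) + 1
  +1-square = solve-∀
+-𝟙-square a (no _)  = +0-square a
  where
  +0-square : ∀ a → (a + 0) * (a + 0) ≡ a * a + 2 * (a * 0) + 0
  +0-square = solve-∀

∑-zero : ∀ {n} {f : Fin n → ℕ} → (∀ i → f i ≡ 0) → sum f ≡ 0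
∑-zero {n} f≗0 = trans (sum-cong-≗ f≗0) (sum-replicate-zero n)

∑-const : ∀ n c → ∑[ i < n ] c ≡ n * c
∑-const zero    c = refl
∑-const (suc n) c = cong (c +_) (∑-const n c)

∑-mono-≤ : ∀ {n} {f g : Fin n → ℕ} → (∀ i → f i ≤ g i) → sum f ≤ sum g
∑-mono-≤ {zero}  f≤g = z≤n
∑-mono-≤ {suc n} f≤g = +-mono-≤ (f≤g zero) (∑-mono-≤ (f≤g ∘ suc))

∑-mono-≤-with-slack : ∀ {n} {f g : Fin n → ℕ} (j : Fin n) {c} →
  (∀ i → f i ≤ g i) → f j + c ≤ g j → sum f + c ≤ sum g
∑-mono-≤-with-slack {suc n} {f} {g} j {c} f≤g fj+c≤gj = begin
  sum f + c                     ≡⟨ cong (_+ c) (sum-remove f) ⟩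
  f j + sum (removeAt f j) + c  ≡⟨ xy∙z≈xz∙y (f j) _ c ⟩
  f j + c + sum (removeAt f j)  ≤⟨ +-mono-≤ fj+c≤gj (∑-mono-≤ {n} (f≤g ∘ punchIn j)) ⟩
  g j + sum (removeAt g j)      ≡⟨ sum-remove g ⟨
  sum g                         ∎
  where open ≤-Reasoning

AtMostOne : ∀ {a p} {A : Set a} → Pred A p → Set (a ⊔ p)
AtMostOne P = ∀ {i j} → P i → P j → i ≡ j

∑-𝟙-none : ∀ {n p} {P : Pred (Fin n) p} (P? : ∀ i → Dec (P i)) → (∀ i → ¬ P i) →
  ∑[ i < n ] 𝟙 (P? i) ≡ 0
∑-𝟙-none P? ¬P = ∑-zero (λ i → 𝟙-no (¬P i) (P? i))

∑-𝟙-atMostOne : ∀ {n p} {P : Pred (Fin n) p} (P? : ∀ i → Dec (P i)) → AtMostOne P →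
  (∃P? : Dec (∃ P)) → ∑[ i < n ] 𝟙 (P? i) ≡ 𝟙 ∃P?
∑-𝟙-atMostOne {zero}  P? _ ∃P? = sym (𝟙-no (λ ()) ∃P?)
∑-𝟙-atMostOne {suc n} {P = P} P? unique ∃P? with P? zero
... | yes p = trans (cong suc (∑-𝟙-none (P? ∘ suc) (λ i q → 0≢1+n (unique p q))))
                    (sym (𝟙-yes (zero , p) ∃P?))
... | no ¬p = trans (∑-𝟙-atMostOne (P? ∘ suc) (λ p q → suc-injective (unique p q)) (any? (P? ∘ suc)))
                    (𝟙-cong (λ (i , q) → suc i , q) from-suc (any? (P? ∘ suc)) ∃P?)
  where
  from-suc : ∃ P → ∃ (P ∘ suc)
  from-suc (zero  , p) = ⊥-elim (¬p p)
  from-suc (suc i , p) = i , p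

∑-𝟙-≤1 : ∀ {n p} {P : Pred (Fin n) p} (P? : ∀ i → Dec (P i)) → AtMostOne P →
  ∑[ i < n ] 𝟙 (P? i) ≤ 1
∑-𝟙-≤1 P? unique = ≤-trans (≤-reflexive (∑-𝟙-atMostOne P? unique (any? P?))) (𝟙-≤1 (any? P?))

∑-𝟙-≟ : ∀ {n} (j : Fin n) → ∑[ i < n ] 𝟙 (i ≟ᶠ j) ≡ 1
∑-𝟙-≟ j = ∑-𝟙-atMostOne (_≟ᶠ j) (λ i≡j k≡j → trans i≡j (sym k≡j)) (yes (j , refl))

∣p∣≡∑𝟙[∈p] : ∀ {n} (p : Subset n) → ∣ p ∣ ≡ ∑[ i < n ] 𝟙 (i ∈? p)
∣p∣≡∑𝟙[∈p] []            = refl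
∣p∣≡∑𝟙[∈p] (inside ∷ p)  = cong suc (trans (∣p∣≡∑𝟙[∈p] p)
  (sum-cong-≗ (λ i → 𝟙-cong there drop-there (i ∈? p) (suc i ∈? (inside ∷ p)))))
∣p∣≡∑𝟙[∈p] (outside ∷ p) = trans (∣p∣≡∑𝟙[∈p] p)
  (sum-cong-≗ (λ i → 𝟙-cong there drop-there (i ∈? p) (suc i ∈? (outside ∷ p))))

2*m*n≤m*m+n*n : ∀ m n → 2 * (m * n) ≤ m * m + n * n
2*m*n≤m*m+n*n m n = [ ordered , ordered-flipped ]′ (≤-total m n)
  where
  square-identity : ∀ m k → m * m + (m + k) * (m + k) ≡ 2 * (m * (m + k)) + k * k
  square-identity = solve-∀
  ordered : ∀ {m n} → m ≤ n → 2 * (m * n) ≤ m * m + n * n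
  ordered {m} m≤n with k , refl ← m≤n⇒∃[o]m+o≡n m≤n =
    subst (2 * (m * (m + k)) ≤_) (sym (square-identity m k)) (m≤m+n _ (k * k))
  ordered-flipped : n ≤ m → 2 * (m * n) ≤ m * m + n * n
  ordered-flipped n≤m = subst₂ _≤_ (cong (2 *_) (*-comm n m)) (+-comm (n * n) (m * m)) (ordered n≤m)

cauchy-schwarz : ∀ {n} (f : Fin n → ℕ) → sum f * sum f ≤ n * ∑[ i < n ] (f i * f i)
cauchy-schwarz {n} f = *-cancelˡ-≤ 2 (begin
  2 * (sum f * sum f)
    ≡⟨ cong (2 *_) sum-square ⟩
  2 * ∑[ i < n ] ∑[ j < n ] (f i * f j)
    ≡⟨ *-distrib-∑∑ 2 ⟩
  ∑[ i < n ] ∑[ j < n ] (2 * (f i * f j))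
    ≤⟨ ∑-mono-≤ {n} (λ i → ∑-mono-≤ {n} (λ j → 2*m*n≤m*m+n*n (f i) (f j))) ⟩
  ∑[ i < n ] ∑[ j < n ] (f i * f i + f j * f j)
    ≡⟨ sum-cong-≗ (λ i → trans (∑-distrib-+ (λ _ → f i * f i) (λ j → f j * f j))
                               (cong (_+ ∑f²) (∑-const n _))) ⟩
  ∑[ i < n ] (n * (f i * f i) + ∑f²)
    ≡⟨ ∑-distrib-+ (λ i → n * (f i * f i)) (λ _ → ∑f²) ⟩
  ∑[ i < n ] (n * (f i * f i)) + ∑[ i < n ] ∑f²
    ≡⟨ cong₂ _+_ (sym (*-distribˡ-sum n (λ i → f i * f i))) (∑-const n ∑f²) ⟩
  n * ∑f² + n * ∑f²
    ≡⟨ cong (n * ∑f² +_) (+-identityʳ _) ⟨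
  2 * (n * ∑f²) ∎)
  where
  open ≤-Reasoning
  ∑f² : ℕ
  ∑f² = ∑[ i < n ] (f i * f i)
  sum-square : sum f * sum f ≡ ∑[ i < n ] ∑[ j < n ] (f i * f j)
  sum-square = trans (*-distribʳ-sum (sum f) f) (sum-cong-≗ (λ i → *-distribˡ-sum (f i) f))
  *-distrib-∑∑ : ∀ c → c * ∑[ i < n ] ∑[ j < n ] (f i * f j) ≡ ∑[ i < n ] ∑[ j < n ] (c * (f i * f j))
  *-distrib-∑∑ c = trans (*-distribˡ-sum c (λ i → ∑[ j < n ] (f i * f j)))
                         (sum-cong-≗ (λ i → *-distribˡ-sum c (λ j → f i * f j)))

x*x≤n*x+2y⇒x*x≤4[y+n*n] : ∀ n x y → x * x ≤ n * x + 2 * y → x * x ≤ 4 * (y + n * n)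
x*x≤n*x+2y⇒x*x≤4[y+n*n] n x y x*x≤ with ≤-total x (2 * n)
... | inj₁ x≤2n = begin
  x * x            ≤⟨ *-mono-≤ x≤2n x≤2n ⟩
  2 * n * (2 * n)  ≡⟨ double-square n ⟩
  4 * (n * n)      ≤⟨ *-monoʳ-≤ 4 (m≤n+m (n * n) y) ⟩
  4 * (y + n * n)  ∎
  where
  open ≤-Reasoning
  double-square : ∀ n → 2 * n * (2 * n) ≡ 4 * (n * n)
  double-square = solve-∀
... | inj₂ 2n≤x = ≤-trans (+-cancelˡ-≤ (x * x) _ _ (begin
  x * x + x * x        ≡⟨ cong (x * x +_) (+-identityʳ (x * x)) ⟨
  2 * (x * x)          ≤⟨ *-monoʳ-≤ 2 x*x≤ ⟩
  2 * (n * x + 2 * y)  ≡⟨ double n x y ⟩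
  2 * n * x + 4 * y    ≤⟨ +-monoˡ-≤ (4 * y) (*-monoˡ-≤ x 2n≤x) ⟩
  x * x + 4 * y        ∎)) (*-monoʳ-≤ 4 (m≤m+n y (n * n)))
  where
  open ≤-Reasoning
  double : ∀ n x y → 2 * (n * x + 2 * y) ≡ 2 * n * x + 4 * y
  double = solve-∀

¬¬-Π : ∀ {n q} {Q : Fin n → Set q} → (∀ i → ¬ ¬ Q i) → ¬ ¬ (∀ i → Q i)
¬¬-Π {zero}  _   k = k (λ ())
¬¬-Π {suc n} ¬¬Q k = ¬¬Q zero (λ q₀ → ¬¬-Π (¬¬Q ∘ suc) (λ qs → k (λ { zero → q₀ ; (suc i) → qs i })))

-- Reachability need not be decidable, but the goal is, and Dec holds up to double negation.
≤-assuming-decidable : ∀ {n r} (R : Rel (Fin n) r) {a b} → (Decidable R → a ≤ b) → a ≤ b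
≤-assuming-decidable R {a} {b} ≤-if-decidable = decidable-stable (a ≤? b)
  (¬¬-map ≤-if-decidable (¬¬-Π (λ x → ¬¬-Π (λ y → ¬¬-excluded-middle))))

-- Counting edges

∈-swap⁺ : ∀ {a b} {A : Set a} {B : Set b} {x : A} {y : B} {xs} →
  (x , y) ∈ₗ xs → (y , x) ∈ₗ map swap xs
∈-swap⁺ = ∈-map⁺ swap

∈-swap⁻ : ∀ {a b} {A : Set a} {B : Set b} {x : A} {y : B} {xs} →
  (y , x) ∈ₗ map swap xs → (x , y) ∈ₗ xs
∈-swap⁻ {xs = xs} yx∈ with ∈-map⁻ swap yx∈
... | _ , p∈xs , yx≡swap-p = subst (_∈ₗ xs) (cong swap (sym yx≡swap-p)) p∈xs

EdgeList : ℕ → Set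
EdgeList n = List (Fin n × Fin n)

module _ {n : ℕ} where

  _≟ₑ_ : (e f : Fin n × Fin n) → Dec (e ≡ f)
  _≟ₑ_ = ≡-dec _≟ᶠ_ _≟ᶠ_

  open import Data.List.Membership.DecPropositional _≟ₑ_ public using () renaming (_∈?_ to _∈ₗ?_)

  indeg : EdgeList n → Fin n → ℕ
  indeg H v = ∑[ u < n ] 𝟙 ((u , v) ∈ₗ? H)

  ∑indeg : EdgeList n → ℕ
  ∑indeg H = ∑[ v < n ] indeg H v

  indeg-cong : ∀ {H H′} → (∀ {e} → e ∈ₗ H → e ∈ₗ H′) → (∀ {e} → e ∈ₗ H′ → e ∈ₗ H) →
    ∀ v → indeg H v ≡ indeg H′ v
  indeg-cong H⊆H′ H′⊆H v = sum-cong-≗ (λ u → 𝟙-cong H⊆H′ H′⊆H ((u , v) ∈ₗ? _) ((u , v) ∈ₗ? _))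

  indeg-[] : ∀ v → indeg [] v ≡ 0
  indeg-[] v = ∑-𝟙-none (λ u → (u , v) ∈ₗ? []) (λ u ())

  𝟙-∈-∷ : ∀ e {y ys} → y ∉ₗ ys → 𝟙 (e ∈ₗ? y ∷ ys) ≡ 𝟙 (e ≟ₑ y) + 𝟙 (e ∈ₗ? ys)
  𝟙-∈-∷ e {y} {ys} y∉ys = split (e ∈ₗ? y ∷ ys) (e ≟ₑ y) (e ∈ₗ? ys)
    where
    split : (e∈y∷ys? : Dec (e ∈ₗ y ∷ ys)) (e≟y : Dec (e ≡ y)) (e∈ys? : Dec (e ∈ₗ ys)) →
      𝟙 e∈y∷ys? ≡ 𝟙 e≟y + 𝟙 e∈ys?
    split e∈y∷ys? (yes refl) (yes e∈ys) = ⊥-elim (y∉ys e∈ys)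
    split e∈y∷ys? (yes e≡y)  (no _)     = 𝟙-yes (here e≡y) e∈y∷ys?
    split e∈y∷ys? (no _)     (yes e∈ys) = 𝟙-yes (there e∈ys) e∈y∷ys?
    split e∈y∷ys? (no e≢y)   (no e∉ys)  =
      𝟙-no (λ { (here e≡y) → e≢y e≡y ; (there e∈ys) → e∉ys e∈ys }) e∈y∷ys?

  𝟙-∈-++ : ∀ e xs ys → 𝟙 (e ∈ₗ? xs ++ ys) ≡ 𝟙 (e ∈ₗ? xs) + 𝟙 ((e ∈ₗ? ys) ×-dec ¬? (e ∈ₗ? xs))
  𝟙-∈-++ e xs ys = split (e ∈ₗ? xs ++ ys) (e ∈ₗ? xs) (e ∈ₗ? ys)
    where
    split : (e∈xs++ys? : Dec (e ∈ₗ xs ++ ys)) (e∈xs? : Dec (e ∈ₗ xs)) (e∈ys? : Dec (e ∈ₗ ys)) →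
      𝟙 e∈xs++ys? ≡ 𝟙 e∈xs? + 𝟙 (e∈ys? ×-dec ¬? e∈xs?)
    split e∈xs++ys? (yes e∈xs) (yes _)    = 𝟙-yes (∈-++⁺ˡ e∈xs) e∈xs++ys?
    split e∈xs++ys? (yes e∈xs) (no _)     = 𝟙-yes (∈-++⁺ˡ e∈xs) e∈xs++ys?
    split e∈xs++ys? (no _)     (yes e∈ys) = 𝟙-yes (∈-++⁺ʳ xs e∈ys) e∈xs++ys?
    split e∈xs++ys? (no e∉xs)  (no e∉ys)  = 𝟙-no ([ e∉xs , e∉ys ]′ ∘ ∈-++⁻ xs) e∈xs++ys?

  ∑∑-𝟙-≟ₑ : ∀ a b → ∑[ v < n ] ∑[ u < n ] 𝟙 ((u , v) ≟ₑ (a , b)) ≡ 1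
  ∑∑-𝟙-≟ₑ a b = trans (sum-cong-≗ column) (∑-𝟙-≟ b)
    where
    column : ∀ v → ∑[ u < n ] 𝟙 ((u , v) ≟ₑ (a , b)) ≡ 𝟙 (v ≟ᶠ b)
    column v = trans
      (∑-𝟙-atMostOne (λ u → (u , v) ≟ₑ (a , b)) (λ p q → cong proj₁ (trans p (sym q))) ∃u?)
      (𝟙-cong (λ (_ , uv≡ab) → cong proj₂ uv≡ab) (λ v≡b → a , cong (a ,_) v≡b) ∃u? (v ≟ᶠ b))
      where
      ∃u? : Dec (∃ λ u → (u , v) ≡ (a , b))
      ∃u? = any? (λ u → (u , v) ≟ₑ (a , b))

  length≡∑indeg : ∀ {H} → Unique H → length H ≡ ∑indeg H
  length≡∑indeg {[]}           _                 = sym (∑-zero indeg-[])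
  length≡∑indeg {(a , b) ∷ ys} (a,b≢ys ∷ unique) = begin
    1 + length ys
      ≡⟨ cong₂ _+_ (sym (∑∑-𝟙-≟ₑ a b)) (length≡∑indeg unique) ⟩
    ∑[ v < n ] ∑[ u < n ] 𝟙 ((u , v) ≟ₑ (a , b)) + ∑indeg ys
      ≡⟨ ∑-distrib-+ (λ v → ∑[ u < n ] 𝟙 ((u , v) ≟ₑ (a , b))) (indeg ys) ⟨
    ∑[ v < n ] (∑[ u < n ] 𝟙 ((u , v) ≟ₑ (a , b)) + indeg ys v)
      ≡⟨ sum-cong-≗ (λ v → sym (∑-distrib-+ (λ u → 𝟙 ((u , v) ≟ₑ (a , b))) (λ u → 𝟙 ((u , v) ∈ₗ? ys)))) ⟩
    ∑[ v < n ] ∑[ u < n ] (𝟙 ((u , v) ≟ₑ (a , b)) + 𝟙 ((u , v) ∈ₗ? ys))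
      ≡⟨ sum-cong-≗ (λ v → sum-cong-≗ (λ u → sym (𝟙-∈-∷ (u , v) a,b∉ys))) ⟩
    ∑indeg ((a , b) ∷ ys) ∎
    where
    open ≡-Reasoning
    a,b∉ys : (a , b) ∉ₗ ys
    a,b∉ys a,b∈ys = All.lookup a,b≢ys a,b∈ys refl

  numEdges≡∑indeg : ∀ H → numEdges H ≡ ∑indeg H
  numEdges≡∑indeg H = trans (length≡∑indeg (deduplicate-! _≟ₑ_ H))
    (sum-cong-≗ (indeg-cong (∈-deduplicate⁻ _≟ₑ_ H) (∈-deduplicate⁺ _≟ₑ_)))

  ∑indeg-swap : ∀ H → ∑indeg (map swap H) ≡ ∑indeg H
  ∑indeg-swap H = trans
    (sum-cong-≗ (λ v → sum-cong-≗ (λ u → 𝟙-cong ∈-swap⁻ ∈-swap⁺ ((u , v) ∈ₗ? map swap H) ((v , u) ∈ₗ? H))))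
    (∑-comm (λ v u → 𝟙 ((v , u) ∈ₗ? H)))

-- Growth rounds

module _ {n : ℕ} where

  Acyclic : Graph n → Set
  Acyclic G = ∀ {u v} → G u v → ¬ Reach G v u

  IsDAG⇒Acyclic : ∀ {G : Graph n} → IsDAG G → Acyclic G
  IsDAG⇒Acyclic {G} dag {u} uv vu = dag u (edge◅walk uv vu)
    where
    edge◅walk : ∀ {x y z} → G x y → Star G y z → TransClosure G x z
    edge◅walk e ε        = [ e ]⁺
    edge◅walk e (f ◅ fs) = e ∷⁺ edge◅walk f fs

  reach-flip⁺ : ∀ {G : Graph n} {x y} → Reach G x y → Reach (flip G) y x
  reach-flip⁺ = reverse (λ e → e)

  reach-flip⁻ : ∀ {G : Graph n} {x y} → Reach (flip G) x y → Reach G y x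
  reach-flip⁻ = reverse (λ e → e)

  Acyclic-flip : ∀ {G : Graph n} → Acyclic G → Acyclic (flip G)
  Acyclic-flip acyclic vu uv = acyclic vu (reach-flip⁻ uv)

  _⊆ᴳ_ : EdgeList n → Graph n → Set
  H ⊆ᴳ G = ∀ {u v} → (u , v) ∈ₗ H → G u v

  ++-⊆ᴳ : ∀ {G : Graph n} {H H′} → H ⊆ᴳ G → H′ ⊆ᴳ G → (H ++ H′) ⊆ᴳ G
  ++-⊆ᴳ {H = H} H⊆G H′⊆G e∈ with ∈-++⁻ H e∈
  ... | inj₁ e∈H  = H⊆G e∈H
  ... | inj₂ e∈H′ = H′⊆G e∈H′

  Chain : Graph n → EdgeList n → Set
  Chain G es = ∀ {a b c d} → (a , b) ∈ₗ es → (c , d) ∈ₗ es →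
    (a , b) ≡ (c , d) ⊎ Reach G b c ⊎ Reach G d a

  reaches-tails : ∀ {G : Graph n} x π → pathEdges (x ∷ π) ⊆ᴳ G →
    ∀ {a b} → (a , b) ∈ₗ pathEdges (x ∷ π) → Reach G x a
  reaches-tails x (y ∷ π) π⊆G (here refl) = ε
  reaches-tails x (y ∷ π) π⊆G (there ab)  = π⊆G (here refl) ◅ reaches-tails y π (π⊆G ∘ there) ab

  pathEdges-chain : ∀ {G : Graph n} π → pathEdges π ⊆ᴳ G → Chain G (pathEdges π)
  pathEdges-chain (x ∷ y ∷ π) π⊆G (here refl) (here refl) = inj₁ refl
  pathEdges-chain (x ∷ y ∷ π) π⊆G (here refl) (there cd)  =
    inj₂ (inj₁ (reaches-tails y π (π⊆G ∘ there) cd))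
  pathEdges-chain (x ∷ y ∷ π) π⊆G (there ab)  (here refl) =
    inj₂ (inj₂ (reaches-tails y π (π⊆G ∘ there) ab))
  pathEdges-chain (x ∷ y ∷ π) π⊆G (there ab)  (there cd)  = pathEdges-chain (y ∷ π) (π⊆G ∘ there) ab cd

  Chain-flip : ∀ {G : Graph n} {es} → Chain G es → Chain (flip G) (map swap es)
  Chain-flip chain ba dc with chain (∈-swap⁻ ba) (∈-swap⁻ dc)
  ... | inj₁ refl       = inj₁ refl
  ... | inj₂ (inj₁ b⇝c) = inj₂ (inj₂ (reach-flip⁺ b⇝c))
  ... | inj₂ (inj₂ d⇝a) = inj₂ (inj₁ (reach-flip⁺ d⇝a))

  Covered : Graph n → EdgeList n → Fin n → Fin n → Set
  Covered G H s v = ∃ λ w → (w , v) ∈ₗ H × Reach G s w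

  Admissible : Graph n → EdgeList n → Fin n → Fin n → Fin n → Set
  Admissible G H s a b = G a b × ((a , b) ∉ₗ H → Reach G s a × ¬ Covered G H s b)

  record BackwardsRound (G : Graph n) (H : EdgeList n) (s : Fin n) (es : EdgeList n) : Set where
    field
      admissible : ∀ {a b} → (a , b) ∈ₗ es → Admissible G H s a b
      chain      : Chain G es

    edges⊆G : es ⊆ᴳ G
    edges⊆G = proj₁ ∘ admissible

  pathEdges-∷ʳ : ∀ (xs : List (Fin n)) u v →
    pathEdges ((xs ++ [ u ]) ++ [ v ]) ≡ pathEdges (xs ++ [ u ]) ++ [ (u , v) ]
  pathEdges-∷ʳ []           u v = refl
  pathEdges-∷ʳ (x ∷ [])     u v = refl
  pathEdges-∷ʳ (x ∷ y ∷ xs) u v = cong ((x , y) ∷_) (pathEdges-∷ʳ (y ∷ xs) u v)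

  module _ {G : Graph n} {H : EdgeList n} (H⊆G : H ⊆ᴳ G) where

    bwdStep-admissible : ∀ {s u v} → BwdStep G H s u v → Admissible G H s u v
    bwdStep-admissible (inj₁ (uv∈H , _))               = H⊆G uv∈H , λ uv∉H → ⊥-elim (uv∉H uv∈H)
    bwdStep-admissible (inj₂ (uncovered , uv , s⇝u)) = uv , λ _ → s⇝u , uncovered

    bwdFrom-admissible : ∀ {s v X} → BwdFrom G H s v X →
      ∀ {a b} → (a , b) ∈ₗ pathEdges (X ++ [ v ]) → Admissible G H s a b
    bwdFrom-admissible (step {u} {v} {X} _ uv rest) ab∈ rewrite pathEdges-∷ʳ X u v
      with ∈-++⁻ (pathEdges (X ++ [ u ])) ab∈
    ... | inj₁ ab∈rest     = bwdFrom-admissible rest ab∈rest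
    ... | inj₂ (here refl) = bwdStep-admissible uv

    backwards-growth-round : ∀ {s t π} → BackwardsGrowth G H s t π →
      BackwardsRound G H s (pathEdges π)
    backwards-growth-round {t = t} (X , refl , grown) = record
      { admissible = bwdFrom-admissible grown
      ; chain      = pathEdges-chain (X ++ [ t ]) (proj₁ ∘ bwdFrom-admissible grown)
      }

    fwdStep-admissible : ∀ {t u v} → FwdStep G H t u v → Admissible (flip G) (map swap H) t v u
    fwdStep-admissible (inj₁ (uv∈H , _))               = H⊆G uv∈H , λ vu∉H → ⊥-elim (vu∉H (∈-swap⁺ uv∈H))
    fwdStep-admissible (inj₂ (uncovered , uv , v⇝t)) = uv , λ _ →
      reach-flip⁺ v⇝t , λ (w , wu∈ , t⇝w) → uncovered (w , ∈-swap⁻ wu∈ , reach-flip⁻ t⇝w)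

    fwdFrom-admissible : ∀ {t u π} → FwdFrom G H t u π →
      ∀ {a b} → (a , b) ∈ₗ pathEdges (u ∷ π) → Admissible (flip G) (map swap H) t b a
    fwdFrom-admissible (step _ uv rest) (here refl) = fwdStep-admissible uv
    fwdFrom-admissible (step _ uv rest) (there ab∈) = fwdFrom-admissible rest ab∈

    forwards-growth-round : ∀ {s t π} → ForwardsGrowth G H s t π →
      BackwardsRound (flip G) (map swap H) t (map swap (pathEdges π))
    forwards-growth-round {s} (rest , refl , grown) = record
      { admissible = fwdFrom-admissible grown ∘ ∈-swap⁻
      ; chain      = Chain-flip (pathEdges-chain (s ∷ rest) (proj₁ ∘ fwdFrom-admissible grown))
      }

-- The potential

module Potential {n} (G : Graph n) (acyclic : Acyclic G) (reach? : Decidable (Reach G)) (S : Subset n) where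

  Exposed : EdgeList n → Fin n → Fin n → Set
  Exposed H t v = Reach G t v × ¬ Covered G H t v

  exposed? : ∀ H t v → Dec (Exposed H t v)
  exposed? H t v = reach? t v ×-dec ¬? (any? (λ w → ((w , v) ∈ₗ? H) ×-dec reach? t w))

  χ : EdgeList n → Fin n → Fin n → ℕ
  χ H t v = 𝟙 (exposed? H t v)

  exposure : EdgeList n → Fin n → ℕ
  exposure H t = ∑[ v < n ] (χ H t v * indeg H v)

  Ψ : EdgeList n → ℕ
  Ψ H = ∑[ t < n ] (𝟙 (t ∈? S) * exposure H t)

  ∑indeg² : EdgeList n → ℕ
  ∑indeg² H = ∑[ v < n ] (indeg H v * indeg H v)

  Invariant : EdgeList n → ℕ → Set
  Invariant H k = ∑indeg² H + 2 * Ψ H ≤ ∑indeg H + 2 * (k * ∣ S ∣)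

  invariant-[] : Invariant [] 0
  invariant-[] = ≤-trans (≤-reflexive (cong₂ (λ a b → a + 2 * b) ∑indeg²-[] Ψ-[])) z≤n
    where
    ∑indeg²-[] : ∑indeg² [] ≡ 0
    ∑indeg²-[] = ∑-zero {n} {f = λ v → indeg [] v * indeg [] v} (λ v → cong (λ d → d * d) (indeg-[] v))
    exposure-[] : ∀ t → exposure [] t ≡ 0
    exposure-[] t = ∑-zero {n} {f = λ v → χ [] t v * indeg [] v}
      (λ v → trans (cong (χ [] t v *_) (indeg-[] v)) (*-zeroʳ (χ [] t v)))
    Ψ-[] : Ψ [] ≡ 0
    Ψ-[] = ∑-zero {n} {f = λ t → 𝟙 (t ∈? S) * exposure [] t}
      (λ t → trans (cong (𝟙 (t ∈? S) *_) (exposure-[] t)) (*-zeroʳ (𝟙 (t ∈? S))))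

  invariant⇒bound : ∀ {H k} → Invariant H k → ∑indeg H * ∑indeg H ≤ 4 * (n * k * ∣ S ∣ + n * n)
  invariant⇒bound {H} {k} inv = x*x≤n*x+2y⇒x*x≤4[y+n*n] n (∑indeg H) (n * k * ∣ S ∣) (begin
    ∑indeg H * ∑indeg H                 ≤⟨ cauchy-schwarz (indeg H) ⟩
    n * ∑indeg² H                       ≤⟨ *-monoʳ-≤ n (≤-trans (m≤m+n _ _) inv) ⟩
    n * (∑indeg H + 2 * (k * ∣ S ∣))     ≡⟨ distribute n (∑indeg H) k ∣ S ∣ ⟩
    n * ∑indeg H + 2 * (n * k * ∣ S ∣)   ∎)
    where
    open ≤-Reasoning
    distribute : ∀ n e k s → n * (e + 2 * (k * s)) ≡ n * e + 2 * (n * k * s)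
    distribute = solve-∀

  module Round {H s es} (s∈S : s ∈ S) (round : BackwardsRound G H s es) where
    open BackwardsRound round

    H′ : EdgeList n
    H′ = H ++ es

    New : Fin n → Fin n → Set
    New u v = (u , v) ∈ₗ es × (u , v) ∉ₗ H

    NewInto : Fin n → Set
    NewInto v = ∃ λ u → New u v

    new? : ∀ u v → Dec (New u v)
    new? u v = ((u , v) ∈ₗ? es) ×-dec ¬? ((u , v) ∈ₗ? H)

    newInto? : ∀ v → Dec (NewInto v)
    newInto? v = any? (λ u → new? u v)

    d d′ grows : Fin n → ℕ
    d        = indeg H
    d′       = indeg H′
    grows v  = 𝟙 (newInto? v)

    Δ : ℕ
    Δ = ∑[ v < n ] (d v * grows v)

    new-unique : ∀ v → AtMostOne (λ u → New u v)
    new-unique v (u₁v , _) (u₂v , _) with chain u₁v u₂v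
    ... | inj₁ refl        = refl
    ... | inj₂ (inj₁ v⇝u₂) = ⊥-elim (acyclic (edges⊆G u₂v) v⇝u₂)
    ... | inj₂ (inj₂ v⇝u₁) = ⊥-elim (acyclic (edges⊆G u₁v) v⇝u₁)

    exposed-anti : ∀ {t v} → Exposed H′ t v → Exposed H t v
    exposed-anti (t⇝v , uncovered′) = t⇝v , λ (w , wv∈H , t⇝w) → uncovered′ (w , ∈-++⁺ˡ wv∈H , t⇝w)

    newInto⇒exposed : ∀ {v} → NewInto v → Exposed H s v
    newInto⇒exposed (u , uv∈es , uv∉H) with admissible uv∈es
    ... | uv , admit = let s⇝u , uncovered = admit uv∉H in s⇝u ◅◅ return uv , uncovered

    newInto⇒¬exposed′ : ∀ {v} → NewInto v → ¬ Exposed H′ s v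
    newInto⇒¬exposed′ (u , uv∈es , uv∉H) (_ , uncovered′) =
      uncovered′ (u , ∈-++⁺ʳ H uv∈es , proj₁ (proj₂ (admissible uv∈es) uv∉H))

    exposed′-newInto-unique : ∀ t → AtMostOne (λ v → Exposed H′ t v × NewInto v)
    exposed′-newInto-unique t ((t⇝v₁ , uncovered₁) , u₁ , u₁v₁ , _) ((t⇝v₂ , uncovered₂) , u₂ , u₂v₂ , _)
      with chain u₁v₁ u₂v₂
    ... | inj₁ refl         = refl
    ... | inj₂ (inj₁ v₁⇝u₂) = ⊥-elim (uncovered₂ (u₂ , ∈-++⁺ʳ H u₂v₂ , t⇝v₁ ◅◅ v₁⇝u₂))
    ... | inj₂ (inj₂ v₂⇝u₁) = ⊥-elim (uncovered₁ (u₁ , ∈-++⁺ʳ H u₁v₁ , t⇝v₂ ◅◅ v₂⇝u₁))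

    indeg-++ : ∀ v → d′ v ≡ d v + grows v
    indeg-++ v = begin
      d′ v
        ≡⟨ sum-cong-≗ (λ u → 𝟙-∈-++ (u , v) H es) ⟩
      ∑[ u < n ] (𝟙 ((u , v) ∈ₗ? H) + 𝟙 (new? u v))
        ≡⟨ ∑-distrib-+ (λ u → 𝟙 ((u , v) ∈ₗ? H)) (λ u → 𝟙 (new? u v)) ⟩
      d v + ∑[ u < n ] 𝟙 (new? u v)
        ≡⟨ cong (d v +_) (∑-𝟙-atMostOne (λ u → new? u v) (new-unique v) (newInto? v)) ⟩
      d v + grows v ∎
      where open ≡-Reasoning

    ∑indeg-++ : ∑indeg H′ ≡ ∑indeg H + sum grows
    ∑indeg-++ = trans (sum-cong-≗ indeg-++) (∑-distrib-+ d grows)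

    ∑indeg²-++ : ∑indeg² H′ ≡ ∑indeg² H + 2 * Δ + sum grows
    ∑indeg²-++ = begin
      ∑[ v < n ] (d′ v * d′ v)
        ≡⟨ sum-cong-≗ (λ v → trans (cong (λ x → x * x) (indeg-++ v)) (+-𝟙-square (d v) (newInto? v))) ⟩
      ∑[ v < n ] (d v * d v + 2 * (d v * grows v) + grows v)
        ≡⟨ ∑-distrib-+ (λ v → d v * d v + 2 * (d v * grows v)) grows ⟩
      ∑[ v < n ] (d v * d v + 2 * (d v * grows v)) + sum grows
        ≡⟨ cong (_+ sum grows) (∑-distrib-+ (λ v → d v * d v) (λ v → 2 * (d v * grows v))) ⟩
      ∑indeg² H + ∑[ v < n ] (2 * (d v * grows v)) + sum grows
        ≡⟨ cong (λ x → ∑indeg² H + x + sum grows) (*-distribˡ-sum 2 (λ v → d v * grows v)) ⟨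
      ∑indeg² H + 2 * Δ + sum grows ∎
      where open ≡-Reasoning

    exposure-++ : ∀ t → exposure H′ t ≤ exposure H t + 1
    exposure-++ t = begin
      ∑[ v < n ] (χ H′ t v * d′ v)
        ≡⟨ sum-cong-≗ (λ v → trans (cong (χ H′ t v *_) (indeg-++ v))
                                   (*-distribˡ-+ (χ H′ t v) (d v) (grows v))) ⟩
      ∑[ v < n ] (χ H′ t v * d v + χ H′ t v * grows v)
        ≡⟨ ∑-distrib-+ (λ v → χ H′ t v * d v) (λ v → χ H′ t v * grows v) ⟩
      ∑[ v < n ] (χ H′ t v * d v) + ∑[ v < n ] (χ H′ t v * grows v)
        ≤⟨ +-mono-≤ (∑-mono-≤ (λ v → *-monoˡ-≤ (d v)
                                     (𝟙-mono exposed-anti (exposed? H′ t v) (exposed? H t v))))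
                    (≤-trans (≤-reflexive (sum-cong-≗ (λ v → sym (𝟙-× (exposed? H′ t v) (newInto? v)))))
                             (∑-𝟙-≤1 (λ v → exposed? H′ t v ×-dec newInto? v) (exposed′-newInto-unique t))) ⟩
      exposure H t + 1 ∎
      where open ≤-Reasoning

    exposure-++-source-at : ∀ v (newInto?v : Dec (NewInto v)) →
      χ H′ s v * (d v + 𝟙 newInto?v) + d v * 𝟙 newInto?v ≤ χ H s v * d v
    exposure-++-source-at v (yes new)
      rewrite 𝟙-no (newInto⇒¬exposed′ new) (exposed? H′ s v) | 𝟙-yes (newInto⇒exposed new) (exposed? H s v)
      = ≤-reflexive (trans (*-identityʳ (d v)) (sym (+-identityʳ (d v))))
    exposure-++-source-at v (no _)
      rewrite +-identityʳ (d v) | *-zeroʳ (d v) | +-identityʳ (χ H′ s v * d v)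
      = *-monoˡ-≤ (d v) (𝟙-mono exposed-anti (exposed? H′ s v) (exposed? H s v))

    exposure-++-source : exposure H′ s + Δ ≤ exposure H s
    exposure-++-source = begin
      exposure H′ s + Δ
        ≡⟨ ∑-distrib-+ (λ v → χ H′ s v * d′ v) (λ v → d v * grows v) ⟨
      ∑[ v < n ] (χ H′ s v * d′ v + d v * grows v)
        ≤⟨ ∑-mono-≤ (λ v → subst (λ x → χ H′ s v * x + d v * grows v ≤ χ H s v * d v) (sym (indeg-++ v))
                                 (exposure-++-source-at v (newInto? v))) ⟩
      exposure H s ∎
      where open ≤-Reasoning

    Ψ-++ : Ψ H′ + Δ ≤ Ψ H + ∣ S ∣
    Ψ-++ = begin
      Ψ H′ + Δ
        ≤⟨ ∑-mono-≤-with-slack s (λ t → *-monoʳ-≤ (𝟙 (t ∈? S)) (exposure-++ t)) at-source ⟩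
      ∑[ t < n ] (𝟙 (t ∈? S) * (exposure H t + 1))
        ≡⟨ sum-cong-≗ (λ t → trans (*-distribˡ-+ (𝟙 (t ∈? S)) (exposure H t) 1)
                                   (cong (𝟙 (t ∈? S) * exposure H t +_) (*-identityʳ (𝟙 (t ∈? S))))) ⟩
      ∑[ t < n ] (𝟙 (t ∈? S) * exposure H t + 𝟙 (t ∈? S))
        ≡⟨ ∑-distrib-+ (λ t → 𝟙 (t ∈? S) * exposure H t) (λ t → 𝟙 (t ∈? S)) ⟩
      Ψ H + ∑[ t < n ] 𝟙 (t ∈? S)
        ≡⟨ cong (Ψ H +_) (∣p∣≡∑𝟙[∈p] S) ⟨
      Ψ H + ∣ S ∣ ∎
      where
      open ≤-Reasoning
      at-source : 𝟙 (s ∈? S) * exposure H′ s + Δ ≤ 𝟙 (s ∈? S) * (exposure H s + 1)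
      at-source rewrite 𝟙-yes s∈S (s ∈? S) | +-identityʳ (exposure H′ s) | +-identityʳ (exposure H s + 1) =
        ≤-trans exposure-++-source (m≤m+n (exposure H s) 1)

    invariant-++ : ∀ {k} → Invariant H k → Invariant H′ (suc k)
    invariant-++ {k} inv = begin
      ∑indeg² H′ + 2 * Ψ H′
        ≡⟨ cong (_+ 2 * Ψ H′) ∑indeg²-++ ⟩
      ∑indeg² H + 2 * Δ + sum grows + 2 * Ψ H′
        ≡⟨ regroup₁ (∑indeg² H) Δ (sum grows) (Ψ H′) ⟩
      ∑indeg² H + sum grows + 2 * (Ψ H′ + Δ)
        ≤⟨ +-monoʳ-≤ (∑indeg² H + sum grows) (*-monoʳ-≤ 2 Ψ-++) ⟩
      ∑indeg² H + sum grows + 2 * (Ψ H + ∣ S ∣)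
        ≡⟨ regroup₂ (∑indeg² H) (sum grows) (Ψ H) ∣ S ∣ ⟩
      (∑indeg² H + 2 * Ψ H) + (sum grows + 2 * ∣ S ∣)
        ≤⟨ +-monoˡ-≤ (sum grows + 2 * ∣ S ∣) inv ⟩
      (∑indeg H + 2 * (k * ∣ S ∣)) + (sum grows + 2 * ∣ S ∣)
        ≡⟨ regroup₃ (∑indeg H) k ∣ S ∣ (sum grows) ⟩
      (∑indeg H + sum grows) + 2 * (suc k * ∣ S ∣)
        ≡⟨ cong (_+ 2 * (suc k * ∣ S ∣)) ∑indeg-++ ⟨
      ∑indeg H′ + 2 * (suc k * ∣ S ∣) ∎
      where
      open ≤-Reasoning
      regroup₁ : ∀ a δ g ψ → a + 2 * δ + g + 2 * ψ ≡ a + g + 2 * (ψ + δ)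
      regroup₁ = solve-∀
      regroup₂ : ∀ a g ψ s → a + g + 2 * (ψ + s) ≡ (a + 2 * ψ) + (g + 2 * s)
      regroup₂ = solve-∀
      regroup₃ : ∀ e k s g → (e + 2 * (k * s)) + (g + 2 * s) ≡ (e + g) + 2 * ((1 + k) * s)
      regroup₃ = solve-∀

  open Round public using (invariant-++)

module _ {n} {G : Graph n} (dag : IsDAG G) (S : Subset n) where

  backwards-bound : Decidable (Reach G) → ∀ {P H} → All (λ st → proj₁ st ∈ S) P →
    OnlineRun BackwardsGrowth G [] P H → numEdges H * numEdges H ≤ 4 * (n * length P * ∣ S ∣ + n * n)
  backwards-bound reach? {H = H} sources run rewrite numEdges≡∑indeg H =
    invariant⇒bound (invariant-run {k = 0} (λ ()) invariant-[] sources run)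
    where
    open Potential G (IsDAG⇒Acyclic dag) reach? S
    invariant-run : ∀ {H P Hf k} → H ⊆ᴳ G → Invariant H k → All (λ st → proj₁ st ∈ S) P →
      OnlineRun BackwardsGrowth G H P Hf → Invariant Hf (k + length P)
    invariant-run {H} {k = k} _ inv [] finish = subst (Invariant H) (sym (+-identityʳ k)) inv
    invariant-run {H} {Hf = Hf} {k} H⊆G inv (s∈S ∷ sources) (round {s = s} {ps = ps} {π = π} grown run) =
      subst (Invariant Hf) (sym (+-suc k (length ps)))
        (invariant-run {k = suc k} (++-⊆ᴳ H⊆G edges⊆G) (invariant-++ s∈S growth {k} inv) sources run)
      where
      growth : BackwardsRound G H s (pathEdges π)
      growth = backwards-growth-round H⊆G grown
      open BackwardsRound growth using (edges⊆G)

  forwards-bound : Decidable (Reach (flip G)) → ∀ {P H} → All (λ st → proj₂ st ∈ S) P →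
    OnlineRun ForwardsGrowth G [] P H → numEdges H * numEdges H ≤ 4 * (n * length P * ∣ S ∣ + n * n)
  forwards-bound reach? {H = H} targets run rewrite numEdges≡∑indeg H | sym (∑indeg-swap H) =
    invariant⇒bound (invariant-run {k = 0} (λ ()) invariant-[] targets run)
    where
    open Potential (flip G) (Acyclic-flip (IsDAG⇒Acyclic dag)) reach? S
    invariant-run : ∀ {H P Hf k} → H ⊆ᴳ G → Invariant (map swap H) k → All (λ st → proj₂ st ∈ S) P →
      OnlineRun ForwardsGrowth G H P Hf → Invariant (map swap Hf) (k + length P)
    invariant-run {H} {k = k} _ inv [] finish = subst (Invariant (map swap H)) (sym (+-identityʳ k)) inv
    invariant-run {H} {Hf = Hf} {k} H⊆G inv (t∈S ∷ targets) (round {t = t} {ps} {π} grown run) =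
      subst (Invariant (map swap Hf)) (sym (+-suc k (length ps)))
        (invariant-run {k = suc k} (++-⊆ᴳ H⊆G (edges⊆G ∘ ∈-swap⁺))
          (subst (λ H′ → Invariant H′ (suc k)) (sym (map-++ swap H (pathEdges π)))
                 (invariant-++ t∈S growth {k} inv))
          targets run)
      where
      growth : BackwardsRound (flip G) (map swap H) t (map swap (pathEdges π))
      growth = forwards-growth-round H⊆G grown
      open BackwardsRound growth using (edges⊆G)

theorem12 : Σ ℕ λ c →
    -- (i) P ⊆ S × V, every path generated by backwards-growth
    (∀ (n : ℕ) (G : Graph n) → IsDAG G → (S : Subset n)
       (P : List (Fin n × Fin n)) →
       All (λ st → Reach G (proj₁ st) (proj₂ st)) P →
       All (λ st → proj₁ st ∈ S) P →
       (H : List (Fin n × Fin n)) → OnlineRun BackwardsGrowth G [] P H →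
       numEdges H * numEdges H ≤ c * (n * length P * ∣ S ∣ + n * n))
    ×
    -- (ii) P ⊆ V × S, every path generated by forwards-growth
    (∀ (n : ℕ) (G : Graph n) → IsDAG G → (S : Subset n)
       (P : List (Fin n × Fin n)) →
       All (λ st → Reach G (proj₁ st) (proj₂ st)) P →
       All (λ st → proj₂ st ∈ S) P →
       (H : List (Fin n × Fin n)) → OnlineRun ForwardsGrowth G [] P H →
       numEdges H * numEdges H ≤ c * (n * length P * ∣ S ∣ + n * n))
theorem12 = 4
  , (λ n G dag S P _ sources H run →
       ≤-assuming-decidable (Reach G) (λ reach? → backwards-bound dag S reach? sources run))
  , (λ n G dag S P _ targets H run →
       ≤-assuming-decidable (Reach (flip G)) (λ reach? → forwards-bound dag S reach? targets run))
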